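{- Let $G$ be a finite simple graph with adjacency matrix $A$, let $S$ be a Godsil-McKay switching set of $G$, and let $G'$ be the graph obtained from $G$ by Godsil-McKay switching with respect to $S$, with adjacency matrix $A'$ (vertices ordered identically). Suppose $\operatorname{rank}_{\mathbb{F}_2}(A)=r$. Then $r$ is even and $\operatorname{rank}_{\mathbb{F}_2}(A')\in\{r-2,\ r,\ r+2\}$.
   Context: A Godsil-McKay switching set of a graph $G$ is a subset $S$ of the vertex set such that $S$ induces a regular subgraph and every vertex outside $S$ is adjacent to exactly $|S|$, $\tfrac12|S|$ or $0$ vertices of $S$. Godsil-McKay switching with respect to $S$ produces the graph $G'$ obtained from $G$ as follows: for each vertex $v\notin S$ with exactly $\tfrac12|S|$ neighbours in $S$, delete the $\tfrac12|S|$ edges between $v$ and $S$ and join $v$ instead to the other $\tfrac12|S|$ vertices of $S$; all other adjacencies are unchanged. The 2-rank of an integer matrix is its rank over $\mathbb{F}_2$ after reduction mod 2. -}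

module Defs where

open import Data.Nat using (ℕ; zero; suc; _+_; _*_; _≡ᵇ_)
open import Data.Bool using (Bool; true; false; _∧_; _∨_; _xor_; not; if_then_else_)
open import Data.Fin using (Fin; zero; suc)
open import Data.Product using (Σ; _×_; ∃)
open import Data.Sum using (_⊎_)
open import Relation.Binary.PropositionalEquality using (_≡_)
open import Relation.Nullary using (¬_)

count : ∀ {n} → (Fin n → Bool) → ℕ
count {zero}  p = 0
count {suc n} p = (if p zero then 1 else 0) + count (λ i → p (suc i))

xorSum : ∀ {n} → (Fin n → Bool) → Bool
xorSum {zero}  f = false
xorSum {suc n} f = f zero xor xorSum (λ i → f (suc i))

-- A finite simple graph on vertex set Fin n, given by its adjacency matrix
-- with entries in Bool (= the adjacency 0/1 matrix reduced mod 2).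
record Graph (n : ℕ) : Set where
  field
    adj   : Fin n → Fin n → Bool
    sym   : ∀ u v → adj u v ≡ adj v u
    irrefl : ∀ v → adj v v ≡ false
open Graph public

VSet : ℕ → Set
VSet n = Fin n → Bool

degIn : ∀ {n} → Graph n → VSet n → Fin n → ℕ
degIn G S v = count (λ u → S u ∧ adj G v u)

IsGMSwitchingSet : ∀ {n} → Graph n → VSet n → Set
IsGMSwitchingSet {n} G S =
  (Σ ℕ λ k → ∀ v → S v ≡ true → degIn G S v ≡ k)
  × (∀ v → S v ≡ false →
       (degIn G S v ≡ count S) ⊎ (2 * degIn G S v ≡ count S) ⊎ (degIn G S v ≡ 0))

halfVertex : ∀ {n} → Graph n → VSet n → Fin n → Bool
halfVertex G S v = not (S v) ∧ (2 * degIn G S v ≡ᵇ count S)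

switchAdj : ∀ {n} → Graph n → VSet n → Fin n → Fin n → Bool
switchAdj G S u v =
  if (S v ∧ halfVertex G S u) ∨ (S u ∧ halfVertex G S v)
  then not (adj G u v) else adj G u v

-- Rank over F₂ of a square Bool matrix M (row i is M i), as the maximum
-- number of linearly independent rows.
IndependentRows : ∀ {n r} → (Fin n → Fin n → Bool) → (Fin r → Fin n) → Set
IndependentRows {n} {r} M rows =
  ∀ (c : Fin r → Bool) →
    (∀ (j : Fin n) → xorSum (λ i → c i ∧ M (rows i) j) ≡ false) →
    ∀ i → c i ≡ false

Rank2 : ∀ {n} → (Fin n → Fin n → Bool) → ℕ → Set
Rank2 {n} M r =
  (Σ (Fin r → Fin n) λ rows → IndependentRows M rows)
  × (∀ (rows : Fin (suc r) → Fin n) → ¬ IndependentRows M rows)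

data Even : ℕ → Set where
  even-zero : Even 0
  even-ss   : ∀ {m} → Even m → Even (suc (suc m))

-- Over F₂ = (Bool, xor, ∧) the switched adjacency matrix is a symmetric
-- rank-two update of the original one: with s the indicator vector of S and
-- h the indicator vector of the vertices outside S having |S|/2 neighbours
-- in S,  A' = A + h sᵀ + s hᵀ  (switch-perturbed).  The theorem then follows
-- from two facts about square F₂-matrices, neither of which needs any further
-- property of the switching set:
--   * an update M' = M + h sᵀ + s hᵀ has rank at most rank M + 2, and the
--     update is its own inverse (perturbed-rank-bound, perturbed-involutive);
--   * an alternating matrix (symmetric, zero diagonal) has even rank
--     (alternating-rank-even): a nonzero entry M a b gives a "hyperbolic pair"
--     of rows, and clearing it is again such an update, lowering the rank by
--     exactly two.
module Submission where

open import Defs hiding (sym)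
open import Data.Nat using (ℕ; zero; suc; _+_; _≤_; _<_; z≤n; s≤s)
open import Data.Product using (Σ; _×_; _,_; proj₁; proj₂; ∃)
open import Data.Sum using (_⊎_; inj₁; inj₂)
open import Relation.Binary.PropositionalEquality
  using (_≡_; refl; sym; trans; cong; cong₂; subst; _≗_; module ≡-Reasoning)

open import Algebra.Bundles using (CommutativeRing)
open import Data.Bool using (Bool; true; false; _∧_; _∨_; _xor_; not; if_then_else_)
open import Data.Bool.Properties
  using (_≟_; xor-∧-commutativeRing; xor-assoc; xor-comm; xor-same; xor-identityʳ;
         ∧-assoc; ∧-comm; ∧-identityʳ; ∧-zeroʳ; ¬-not)
open import Data.Empty using (⊥; ⊥-elim)
open import Data.Fin using (Fin; zero; suc; punchIn)
open import Data.Fin.Properties using (any?; all?)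
open import Data.Fin.Subset.Properties using (anySubset?)
open import Data.Maybe using (Maybe; just; nothing)
open import Data.Nat.Induction using (<-rec)
open import Data.Nat.Properties using (≤-antisym; m≤n⇒m≤1+n; m<n⇒m<1+n; n<1+n; n≮n)
open import Data.Vec using (lookup; tabulate)
open import Data.Vec.Properties using (lookup∘tabulate)
open import Data.Vec.Functional using (Vector; _∷_; insertAt)
open import Data.Vec.Functional.Properties using (insertAt-lookup; insertAt-punchIn)
open import Function using (_∘_; const)
open import Relation.Nullary using (¬_; Dec; yes; no)
open import Relation.Nullary.Decidable using (map′)
open import Tactic.RingSolver using (solve-∀)
open import Tactic.RingSolver.Core.AlmostCommutativeRing using (AlmostCommutativeRing; fromCommutativeRing)

open import Algebra.Properties.Semiring.Sum (CommutativeRing.semiring xor-∧-commutativeRing)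
  using (sum; sum-syntax; sum-cong-≗; sum-replicate-zero; sum-remove; ∑-distrib-+; ∑-comm;
         *-distribˡ-sum; *-distribʳ-sum)

open ≡-Reasoning

private variable
  k m n p q r : ℕ

-- F₂ as a ring for the ring solver (identities in characteristic two that
-- use 1 + 1 = 0 are handled separately with xor-same).
F₂ : AlmostCommutativeRing _ _
F₂ = fromCommutativeRing xor-∧-commutativeRing zero≟
  where
  zero≟ : ∀ x → Maybe (false ≡ x)
  zero≟ false = just refl
  zero≟ true  = nothing

xorSum-is-sum : (g : Fin n → Bool) → xorSum g ≡ sum g
xorSum-is-sum {zero}  g = refl
xorSum-is-sum {suc n} g = cong (g zero xor_) (xorSum-is-sum (g ∘ suc))

sum-zeros : (g : Fin n → Bool) → (∀ i → g i ≡ false) → ∑[ i < n ] g i ≡ false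
sum-zeros {n} g g≡0 = trans (sum-cong-≗ g≡0) (sum-replicate-zero n)

infixl 6 _+ᵥ_
infixr 7 _·ᵥ_

_+ᵥ_ : Vector Bool m → Vector Bool m → Vector Bool m
(u +ᵥ v) j = u j xor v j

_·ᵥ_ : Bool → Vector Bool m → Vector Bool m
(x ·ᵥ v) j = x ∧ v j

lc : (Fin k → Bool) → (Fin k → Vector Bool m) → Vector Bool m
lc {k = k} c f j = ∑[ i < k ] (c i ∧ f i j)

Independent : (Fin k → Vector Bool m) → Set
Independent {k = k} f = ∀ (c : Fin k → Bool) → (∀ j → lc c f j ≡ false) → ∀ i → c i ≡ false

InSpan : (Fin k → Vector Bool m) → Vector Bool m → Set
InSpan {k = k} f v = Σ (Fin k → Bool) λ c → lc c f ≗ v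

lc-linear : (c e : Fin k → Bool) (x : Bool) (f : Fin k → Vector Bool m) →
            lc (c +ᵥ x ·ᵥ e) f ≗ lc c f +ᵥ x ·ᵥ lc e f
lc-linear {k = k} c e x f j = begin
  ∑[ i < k ] ((c i xor (x ∧ e i)) ∧ f i j)              ≡⟨ sum-cong-≗ (λ i → expand (c i) x (e i) (f i j)) ⟩
  ∑[ i < k ] ((c i ∧ f i j) xor (x ∧ (e i ∧ f i j)))    ≡⟨ ∑-distrib-+ (λ i → c i ∧ f i j) (λ i → x ∧ (e i ∧ f i j)) ⟩
  lc c f j xor ∑[ i < k ] (x ∧ (e i ∧ f i j))          ≡⟨ cong (lc c f j xor_) (sym (*-distribˡ-sum x (λ i → e i ∧ f i j))) ⟩
  lc c f j xor (x ∧ lc e f j)                          ∎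
  where
  expand : ∀ c x e y → (c xor (x ∧ e)) ∧ y ≡ (c ∧ y) xor (x ∧ (e ∧ y))
  expand = solve-∀ F₂

span-≗ : {f : Fin k → Vector Bool m} {u v : Vector Bool m} → u ≗ v → InSpan f u → InSpan f v
span-≗ u≗v (c , c≗u) = c , λ j → trans (c≗u j) (u≗v j)

span-+· : {f : Fin k → Vector Bool m} {u v : Vector Bool m} (x : Bool) →
          InSpan f u → InSpan f v → InSpan f (u +ᵥ x ·ᵥ v)
span-+· {f = f} x (c , c≗u) (e , e≗v) =
  c +ᵥ x ·ᵥ e , λ j → trans (lc-linear c e x f j) (cong₂ (λ s t → s xor (x ∧ t)) (c≗u j) (e≗v j))

span-head : {f : Fin (suc k) → Vector Bool m} → InSpan f (f zero)
span-head {k = k} {f = f} = true ∷ const false , λ j →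
  trans (cong (f zero j xor_) (sum-zeros {k} (λ _ → false) (λ _ → refl))) (xor-identityʳ (f zero j))

span-tail : {f : Fin (suc k) → Vector Bool m} {v : Vector Bool m} → InSpan (f ∘ suc) v → InSpan f v
span-tail (c , c≗v) = false ∷ c , c≗v

span-member : {f : Fin k → Vector Bool m} (i : Fin k) → InSpan f (f i)
span-member {f = f} zero    = span-head {f = f}
span-member {f = f} (suc i) = span-tail {f = f} (span-member i)

span-drop-head : {f : Fin (suc k) → Vector Bool m} {v : Vector Bool m} →
                 (v∈ : InSpan f v) → proj₁ v∈ zero ≡ false → InSpan (f ∘ suc) v
span-drop-head {f = f} (c , c≗v) c₀≡0 =
  c ∘ suc , λ j → trans (cong (λ x → (x ∧ f zero j) xor lc (c ∘ suc) (f ∘ suc) j) (sym c₀≡0)) (c≗v j)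

span-empty : {f : Fin 0 → Vector Bool m} {v : Vector Bool m} → InSpan f v → ∀ j → v j ≡ false
span-empty (_ , c≗v) j = sym (c≗v j)

span-trans : {f : Fin k → Vector Bool m} {g : Fin q → Vector Bool m} {v : Vector Bool m} →
             (∀ i → InSpan g (f i)) → InSpan f v → InSpan g v
span-trans {k = k} {q = q} {f = f} {g = g} {v = v} f∈ (c , c≗v) = e , λ j → begin
  ∑[ l < q ] (∑[ i < k ] (c i ∧ d i l) ∧ g l j)        ≡⟨ sum-cong-≗ (λ l → *-distribʳ-sum (g l j) (λ i → c i ∧ d i l)) ⟩
  ∑[ l < q ] ∑[ i < k ] ((c i ∧ d i l) ∧ g l j)        ≡⟨ ∑-comm (λ l i → (c i ∧ d i l) ∧ g l j) ⟩
  ∑[ i < k ] ∑[ l < q ] ((c i ∧ d i l) ∧ g l j)        ≡⟨ sum-cong-≗ (λ i → sum-cong-≗ (λ l → ∧-assoc (c i) (d i l) (g l j))) ⟩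
  ∑[ i < k ] ∑[ l < q ] (c i ∧ (d i l ∧ g l j))        ≡⟨ sum-cong-≗ (λ i → sym (*-distribˡ-sum (c i) (λ l → d i l ∧ g l j))) ⟩
  ∑[ i < k ] (c i ∧ lc (d i) g j)                      ≡⟨ sum-cong-≗ (λ i → cong (c i ∧_) (proj₂ (f∈ i) j)) ⟩
  lc c f j                                             ≡⟨ c≗v j ⟩
  v j                                                  ∎
  where
  d : Fin k → Fin q → Bool
  d i = proj₁ (f∈ i)
  e : Fin q → Bool
  e l = ∑[ i < k ] (c i ∧ d i l)

-- Membership in a span is decidable, by searching all coefficient vectors.
InSpan? : (f : Fin k → Vector Bool m) (v : Vector Bool m) → Dec (InSpan f v)
InSpan? f v = map′ (λ (c , c≗v) → lookup c , c≗v) (λ (c , c≗v) → tabulate c , tabulated c c≗v)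
  (anySubset? (λ c → all? (λ j → lc (lookup c) f j ≟ v j)))
  where
  tabulated : ∀ c → lc c f ≗ v → lc (lookup (tabulate c)) f ≗ v
  tabulated c c≗v j = trans (sum-cong-≗ (λ i → cong (_∧ f i j) (lookup∘tabulate c i))) (c≗v j)

zero-family-dependent : (a : Fin (suc p) → Vector Bool m) → Independent a → (∀ i j → a i j ≡ false) → ⊥
zero-family-dependent {p = p} a ind a≡0 with ind (const true) (λ j → sum-zeros {suc p} _ (λ i → a≡0 i j)) zero
... | ()

extend : (f : Fin (suc k) → Vector Bool m) → Independent (f ∘ suc) → ¬ InSpan (f ∘ suc) (f zero) →
         Independent f
extend f ind f₀∉ c comb≡0 = coefficients-vanish
  where
  rest : Vector Bool _
  rest = lc (c ∘ suc) (f ∘ suc)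
  head-free : c zero ≡ false
  head-free = ¬-not λ c₀≡1 → f₀∉ (c ∘ suc , λ j →
    xor-≡-false (subst (λ x → (x ∧ f zero j) xor rest j ≡ false) c₀≡1 (comb≡0 j)))
    where
    xor-≡-false : ∀ {x y} → x xor y ≡ false → y ≡ x
    xor-≡-false {true}  {true}  _ = refl
    xor-≡-false {false} {false} _ = refl
  coefficients-vanish : ∀ i → c i ≡ false
  coefficients-vanish zero    = head-free
  coefficients-vanish (suc i) =
    ind (c ∘ suc) (λ j → subst (λ x → (x ∧ f zero j) xor rest j ≡ false) head-free (comb≡0 j)) i

pivot-∉ : {f : Fin k → Vector Bool m} {v : Vector Bool m} (j : Fin m) →
          v j ≡ true → (∀ i → f i j ≡ false) → ¬ InSpan f v
pivot-∉ {k = k} {f = f} {v} j vⱼ≡1 fⱼ≡0 (c , c≗v) = true≢false (begin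
  true       ≡⟨ vⱼ≡1 ⟨
  v j        ≡⟨ c≗v j ⟨
  lc c f j   ≡⟨ sum-zeros {k} _ (λ i → trans (cong (c i ∧_) (fⱼ≡0 i)) (∧-zeroʳ (c i))) ⟩
  false      ∎)
  where
  true≢false : true ≡ false → ⊥
  true≢false ()

eliminate-independent : (a : Fin (suc p) → Vector Bool m) (x : Fin (suc p) → Bool) (k : Fin (suc p)) →
  Independent a → Independent (λ i → a (punchIn k i) +ᵥ x (punchIn k i) ·ᵥ a k)
eliminate-independent {p = p} a x k ind c comb≡0 i = begin
  c i               ≡⟨ sym (insertAt-punchIn c k t i) ⟩
  C (punchIn k i)   ≡⟨ ind C C-comb≡0 (punchIn k i) ⟩
  false             ∎
  where
  t : Bool
  t = ∑[ l < p ] (c l ∧ x (punchIn k l))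
  C : Fin (suc p) → Bool
  C = insertAt c k t
  rest : Vector Bool _
  rest j = ∑[ l < p ] (c l ∧ a (punchIn k l) j)
  expand : ∀ c A x K → c ∧ (A xor (x ∧ K)) ≡ (c ∧ A) xor ((c ∧ x) ∧ K)
  expand = solve-∀ F₂
  C-comb≡0 : ∀ j → lc C a j ≡ false
  C-comb≡0 j = begin
    lc C a j                                            ≡⟨ sum-remove {i = k} (λ l → C l ∧ a l j) ⟩
    (C k ∧ a k j) xor ∑[ l < p ] (C (punchIn k l) ∧ a (punchIn k l) j)
      ≡⟨ cong₂ (λ s u → (s ∧ a k j) xor u) (insertAt-lookup c k t)
               (sum-cong-≗ (λ l → cong (_∧ a (punchIn k l) j) (insertAt-punchIn c k t l))) ⟩
    (t ∧ a k j) xor rest j                              ≡⟨ xor-comm _ (rest j) ⟩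
    rest j xor (t ∧ a k j)                              ≡⟨ cong (rest j xor_) (*-distribʳ-sum (a k j) (λ l → c l ∧ x (punchIn k l))) ⟩
    rest j xor ∑[ l < p ] ((c l ∧ x (punchIn k l)) ∧ a k j)   ≡⟨ ∑-distrib-+ (λ l → c l ∧ a (punchIn k l) j) (λ l → (c l ∧ x (punchIn k l)) ∧ a k j) ⟨
    ∑[ l < p ] ((c l ∧ a (punchIn k l) j) xor ((c l ∧ x (punchIn k l)) ∧ a k j))
                                                        ≡⟨ sum-cong-≗ (λ l → expand (c l) _ _ _) ⟨
    lc c (λ i → a (punchIn k i) +ᵥ x (punchIn k i) ·ᵥ a k) j  ≡⟨ comb≡0 j ⟩
    false                                               ∎

-- Induction on q: if no aᵢ uses b₀, drop b₀; otherwise eliminate b₀ using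
-- a pivot a_k, leaving p - 1 independent vectors in the span of the rest.
steinitz : (a : Fin p → Vector Bool m) (b : Fin q → Vector Bool m) →
           Independent a → (∀ i → InSpan b (a i)) → p ≤ q
steinitz {p = zero}             a b ind a∈ = z≤n
steinitz {p = suc p} {q = zero}  a b ind a∈ = ⊥-elim (zero-family-dependent a ind (λ i → span-empty {f = b} (a∈ i)))
steinitz {p = suc p} {q = suc q} a b ind a∈ = by-pivot (any? (λ i → x i ≟ true))
  where
  -- x i is the coefficient of b₀ in the chosen combination for aᵢ
  x : Fin (suc p) → Bool
  x i = proj₁ (a∈ i) zero
  by-pivot : Dec (∃ λ i → x i ≡ true) → suc p ≤ suc q
  by-pivot (no b₀-unused) =
    m≤n⇒m≤1+n (steinitz a (b ∘ suc) ind (λ i → span-drop-head {f = b} (a∈ i) (¬-not (λ xᵢ≡1 → b₀-unused (i , xᵢ≡1)))))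
  by-pivot (yes (k , xₖ≡1)) =
    s≤s (steinitz _ (b ∘ suc) (eliminate-independent a x k ind) (λ i →
      span-drop-head {f = b} (span-+· {f = b} (x (punchIn k i)) (a∈ (punchIn k i)) (a∈ k)) (b₀-cancels (x (punchIn k i)))))
    where
    b₀-cancels : ∀ y → y xor (y ∧ x k) ≡ false
    b₀-cancels y rewrite xₖ≡1 | ∧-identityʳ y = xor-same y

Matrix : ℕ → Set
Matrix n = Fin n → Fin n → Bool

rows-independent : (M : Matrix n) (rows : Fin r → Fin n) → IndependentRows M rows → Independent (M ∘ rows)
rows-independent M rows ind c comb≡0 = ind c (λ j → trans (xorSum-is-sum (λ i → c i ∧ M (rows i) j)) (comb≡0 j))

independent-rows : (M : Matrix n) (rows : Fin r → Fin n) → Independent (M ∘ rows) → IndependentRows M rows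
independent-rows M rows ind c comb≡0 = ind c (λ j → trans (sym (xorSum-is-sum (λ i → c i ∧ M (rows i) j))) (comb≡0 j))

basisRows : {M : Matrix n} → Rank2 M r → Fin r → Fin n
basisRows ((rows , _) , _) = rows

rank-spans : {M : Matrix n} (rk : Rank2 M r) → ∀ i → InSpan (M ∘ basisRows {M = M} rk) (M i)
rank-spans {M = M} ((rows , ind) , maximal) i with InSpan? (M ∘ rows) (M i)
... | yes Mᵢ∈ = Mᵢ∈
... | no Mᵢ∉ = ⊥-elim (maximal (i ∷ rows) (independent-rows M (i ∷ rows)
  (extend (M ∘ (i ∷ rows)) (rows-independent M rows ind) Mᵢ∉)))

rank-≤-span : {M : Matrix n} → Rank2 M r → (F : Fin q → Vector Bool n) → (∀ i → InSpan F (M i)) → r ≤ q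
rank-≤-span {M = M} ((rows , ind) , _) F M∈ = steinitz (M ∘ rows) F (rows-independent M rows ind) (M∈ ∘ rows)

rank-≥-independent : {M : Matrix n} → Rank2 M r → (F : Fin p → Vector Bool n) →
                     Independent F → (∀ i → InSpan M (F i)) → p ≤ r
rank-≥-independent {M = M} rk F ind F∈ =
  steinitz F (M ∘ basisRows {M = M} rk) ind (λ i → span-trans (rank-spans rk) (F∈ i))

record Basis (g : Fin k → Vector Bool m) : Set where
  field
    dim         : ℕ
    pick        : Fin dim → Fin k
    independent : Independent (g ∘ pick)
    spanning    : ∀ i → InSpan (g ∘ pick) (g i)

basis : (g : Fin k → Vector Bool m) → Basis g
basis {k = zero}  g = record { dim = 0 ; pick = λ () ; independent = λ _ _ () ; spanning = λ () }
basis {k = suc k} g = add-first (basis (g ∘ suc))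
  where
  add-first : Basis (g ∘ suc) → Basis g
  add-first B = keep-or-add (InSpan? (g ∘ suc ∘ pick) (g zero))
    where
    open Basis B
    pick′ : Fin (suc dim) → Fin (suc k)
    pick′ = zero ∷ suc ∘ pick
    keep-or-add : Dec (InSpan (g ∘ suc ∘ pick) (g zero)) → Basis g
    keep-or-add (yes g₀∈) = record
      { dim = dim ; pick = suc ∘ pick ; independent = independent
      ; spanning = λ { zero → g₀∈ ; (suc i) → spanning i } }
    keep-or-add (no g₀∉) = record
      { dim = suc dim ; pick = pick′ ; independent = extend (g ∘ pick′) independent g₀∉
      ; spanning = λ { zero → span-head {f = g ∘ pick′} ; (suc i) → span-tail {f = g ∘ pick′} (spanning i) } }

rank-exists : (M : Matrix n) → Σ ℕ (Rank2 M)
rank-exists M = dim , (pick , independent-rows M pick independent) , λ rows ind →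
  n≮n dim (steinitz (M ∘ rows) (M ∘ pick) (rows-independent M rows ind) (spanning ∘ rows))
  where open Basis (basis M)

record Perturbed (M : Matrix n) (h s : Vector Bool n) (M' : Matrix n) : Set where
  constructor perturbed
  field entries : ∀ i → M' i ≗ M i +ᵥ h i ·ᵥ s +ᵥ s i ·ᵥ h

-- In characteristic two the update undoes itself.
perturbed-involutive : {M M' : Matrix n} {h s : Vector Bool n} → Perturbed M h s M' → Perturbed M' h s M
perturbed-involutive {M = M} {M'} {h} {s} (perturbed M'≗) = perturbed λ i j → begin
  M i j                                              ≡⟨ add-twice (M i j) (h i ∧ s j) (s i ∧ h j) ⟨
  (((M i j xor (h i ∧ s j)) xor (s i ∧ h j)) xor (h i ∧ s j)) xor (s i ∧ h j)
                                                     ≡⟨ cong (λ x → (x xor (h i ∧ s j)) xor (s i ∧ h j)) (M'≗ i j) ⟨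
  (M' i j xor (h i ∧ s j)) xor (s i ∧ h j)           ∎
  where
  regroup : ∀ m x y → (((m xor x) xor y) xor x) xor y ≡ m xor ((x xor x) xor (y xor y))
  regroup = solve-∀ F₂
  add-twice : ∀ m x y → (((m xor x) xor y) xor x) xor y ≡ m
  add-twice m x y = begin
    (((m xor x) xor y) xor x) xor y     ≡⟨ regroup m x y ⟩
    m xor ((x xor x) xor (y xor y))     ≡⟨ cong₂ (λ a b → m xor (a xor b)) (xor-same x) (xor-same y) ⟩
    m xor false                         ≡⟨ xor-identityʳ m ⟩
    m                                   ∎

Alternating : Matrix n → Set
Alternating M = (∀ u v → M u v ≡ M v u) × (∀ v → M v v ≡ false)

perturbed-alternating : {M M' : Matrix n} {h s : Vector Bool n} →
                        Perturbed M h s M' → Alternating M → Alternating M'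
perturbed-alternating {M = M} {M'} {h} {s} (perturbed M'≗) (symmetric , diagonal) = symmetric' , diagonal'
  where
  swap : ∀ m a b c d → (m xor (a ∧ b)) xor (c ∧ d) ≡ (m xor (d ∧ c)) xor (b ∧ a)
  swap = solve-∀ F₂
  symmetric' : ∀ u v → M' u v ≡ M' v u
  symmetric' u v = begin
    M' u v                                         ≡⟨ M'≗ u v ⟩
    (M u v xor (h u ∧ s v)) xor (s u ∧ h v)         ≡⟨ cong (λ m → (m xor (h u ∧ s v)) xor (s u ∧ h v)) (symmetric u v) ⟩
    (M v u xor (h u ∧ s v)) xor (s u ∧ h v)         ≡⟨ swap (M v u) (h u) (s v) (s u) (h v) ⟩
    (M v u xor (h v ∧ s u)) xor (s v ∧ h u)         ≡⟨ M'≗ v u ⟨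
    M' v u                                         ∎
  diagonal' : ∀ v → M' v v ≡ false
  diagonal' v = begin
    M' v v                                         ≡⟨ M'≗ v v ⟩
    (M v v xor (h v ∧ s v)) xor (s v ∧ h v)         ≡⟨ cong (λ m → (m xor (h v ∧ s v)) xor (s v ∧ h v)) (diagonal v) ⟩
    (h v ∧ s v) xor (s v ∧ h v)                     ≡⟨ cong ((h v ∧ s v) xor_) (∧-comm (s v) (h v)) ⟩
    (h v ∧ s v) xor (h v ∧ s v)                     ≡⟨ xor-same (h v ∧ s v) ⟩
    false                                          ∎

perturbed-row-span : {M M' : Matrix n} {h s : Vector Bool n} {F : Fin k → Vector Bool n} →
                     Perturbed M h s M' → InSpan F h → InSpan F s → ∀ i → InSpan F (M i) → InSpan F (M' i)
perturbed-row-span {h = h} {s} (perturbed M'≗) h∈ s∈ i Mᵢ∈ = span-≗ (sym ∘ M'≗ i) (span-+· (s i) (span-+· (h i) Mᵢ∈ s∈) h∈)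

-- The update raises the rank by at most two: the new rows lie in the span
-- of s, h and a basis of the old rows.
perturbed-rank-bound : {M M' : Matrix n} {h s : Vector Bool n} →
                       Perturbed M h s M' → Rank2 M r → Rank2 M' q → q ≤ 2 + r
perturbed-rank-bound {n = n} {r = r} {M = M} {h = h} {s} M'≗ rk rk' = rank-≤-span rk' F (λ i →
  perturbed-row-span {F = F} M'≗ (span-tail {f = F} (span-head {f = h ∷ B})) (span-head {f = F}) i
    (span-tail {f = F} (span-tail {f = h ∷ B} (rank-spans rk i))))
  where
  B : Fin r → Vector Bool n
  B = M ∘ basisRows {M = M} rk
  F : Fin (2 + r) → Vector Bool n
  F = s ∷ h ∷ B

nonzero-entry : {M : Matrix n} → Rank2 M (suc r) → Σ (Fin n) λ a → Σ (Fin n) λ b → M a b ≡ true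
nonzero-entry {M = M} ((rows , ind) , _) with any? (λ a → any? (λ b → M a b ≟ true))
... | yes entry = entry
... | no none = ⊥-elim (zero-family-dependent (M ∘ rows) (rows-independent M rows ind)
                          (λ i j → ¬-not (λ Mᵢⱼ≡1 → none (rows i , j , Mᵢⱼ≡1))))

clearPair : Matrix n → Fin n → Fin n → Matrix n
clearPair M a b i = M i +ᵥ M a i ·ᵥ M b +ᵥ M b i ·ᵥ M a

clearPair-perturbed : (M : Matrix n) (a b : Fin n) → Perturbed M (M a) (M b) (clearPair M a b)
clearPair-perturbed M a b = perturbed λ i j → refl

clearPair-column-a : {M : Matrix n} {a b : Fin n} → Alternating M → M a b ≡ true → ∀ i → clearPair M a b i a ≡ false
clearPair-column-a {M = M} {a} {b} (symmetric , diagonal) Mab≡1 i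
  rewrite symmetric a i | symmetric b a | Mab≡1 | diagonal a | ∧-identityʳ (M i a) | ∧-zeroʳ (M b i)
  = trans (xor-identityʳ _) (xor-same (M i a))

clearPair-column-b : {M : Matrix n} {a b : Fin n} → Alternating M → M a b ≡ true → ∀ i → clearPair M a b i b ≡ false
clearPair-column-b {M = M} {a} {b} (symmetric , diagonal) Mab≡1 i
  rewrite symmetric b i | Mab≡1 | diagonal b | ∧-identityʳ (M i b) | ∧-zeroʳ (M a i) | xor-identityʳ (M i b)
  = xor-same (M i b)

-- Clearing a hyperbolic pair lowers the rank by exactly two: the rows b, a
-- together with a basis of M̃ form a basis of the row space of M.
clearPair-rank : {M : Matrix n} {a b : Fin n} → Alternating M → M a b ≡ true →
                 Rank2 M r → Rank2 (clearPair M a b) k → r ≡ 2 + k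
clearPair-rank {n = n} {r = r} {k = k} {M = M} {a} {b} alt@(symmetric , diagonal) Mab≡1 rk rk̃ =
  ≤-antisym upper lower
  where
  M̃ : Matrix n
  M̃ = clearPair M a b
  B̃ : Fin k → Vector Bool n
  B̃ = M̃ ∘ basisRows {M = M̃} rk̃
  F : Fin (2 + k) → Vector Bool n
  F = M b ∷ M a ∷ B̃
  upper : r ≤ 2 + k
  upper = perturbed-rank-bound (perturbed-involutive (clearPair-perturbed M a b)) rk̃ rk
  column-a : ∀ i → (M a ∷ B̃) i a ≡ false
  column-a zero    = diagonal a
  column-a (suc l) = clearPair-column-a alt Mab≡1 _
  F-independent : Independent F
  F-independent = extend F
    (extend (M a ∷ B̃) (rows-independent M̃ _ (proj₂ (proj₁ rk̃)))
            (pivot-∉ {f = B̃} b Mab≡1 (λ l → clearPair-column-b alt Mab≡1 _)))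
    (pivot-∉ {f = M a ∷ B̃} a (trans (symmetric b a) Mab≡1) column-a)
  F-in-rows : ∀ i → InSpan M (F i)
  F-in-rows zero          = span-member b
  F-in-rows (suc zero)    = span-member a
  F-in-rows (suc (suc l)) =
    perturbed-row-span {F = M} (clearPair-perturbed M a b) (span-member a) (span-member b) _ (span-member _)
  lower : 2 + k ≤ r
  lower = rank-≥-independent rk F F-independent F-in-rows

-- Alternating matrices have even rank, by strong induction on the rank:
-- a nonzero rank gives a nonzero entry, and clearing that pair leaves an
-- alternating matrix of rank two less.
alternating-rank-even : ∀ r {n} {M : Matrix n} → Alternating M → Rank2 M r → Even r
alternating-rank-even = <-rec _ even-below
  where
  even-below : ∀ r → (∀ {s} → s < r → ∀ {n} {M : Matrix n} → Alternating M → Rank2 M s → Even s) →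
               ∀ {n} {M : Matrix n} → Alternating M → Rank2 M r → Even r
  even-below zero    _       _   _  = even-zero
  even-below (suc r) smaller {M = M} alt rk with nonzero-entry rk
  ... | a , b , Mab≡1 with rank-exists (clearPair M a b)
  ... | k , rk̃ = subst Even (sym r≡2+k)
        (even-ss (smaller (subst (k <_) (sym r≡2+k) (m<n⇒m<1+n (n<1+n k)))
                  (perturbed-alternating (clearPair-perturbed M a b) alt) rk̃))
    where
    r≡2+k : suc r ≡ 2 + k
    r≡2+k = clearPair-rank alt Mab≡1 rk rk̃

if-flip : ∀ c a → (if c then not a else a) ≡ a xor c
if-flip true  a = xor-comm true a
if-flip false a = sym (xor-identityʳ a)

-- A half vertex lies outside S, so the two flip conditions of switchAdj are
-- never both true and their disjunction is their sum.
flip-condition : ∀ su sv bu bv →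
  (sv ∧ (not su ∧ bu)) ∨ (su ∧ (not sv ∧ bv)) ≡ ((not su ∧ bu) ∧ sv) xor (su ∧ (not sv ∧ bv))
flip-condition true  true  _     _ = refl
flip-condition true  false _     _ = refl
flip-condition false true  true  _ = refl
flip-condition false true  false _ = refl
flip-condition false false true  _ = refl
flip-condition false false false _ = refl

switch-perturbed : (G : Graph n) (S : VSet n) → Perturbed (adj G) (halfVertex G S) S (switchAdj G S)
switch-perturbed G S = perturbed λ u v → begin
  switchAdj G S u v                                 ≡⟨ if-flip _ (adj G u v) ⟩
  adj G u v xor ((S v ∧ h u) ∨ (S u ∧ h v))          ≡⟨ cong (adj G u v xor_) (flip-condition (S u) (S v) _ _) ⟩
  adj G u v xor ((h u ∧ S v) xor (S u ∧ h v))        ≡⟨ xor-assoc (adj G u v) _ _ ⟨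
  (adj G u v xor (h u ∧ S v)) xor (S u ∧ h v)        ∎
  where
  h : VSet _
  h = halfVertex G S

even-gap : ∀ {a b} → Even a → Even b → a ≤ 2 + b → b ≤ 2 + a → (a + 2 ≡ b) ⊎ (a ≡ b) ⊎ (a ≡ b + 2)
even-gap even-zero              even-zero              _ _ = inj₂ (inj₁ refl)
even-gap even-zero              (even-ss even-zero)    _ _ = inj₁ refl
even-gap (even-ss even-zero)    even-zero              _ _ = inj₂ (inj₂ refl)
even-gap even-zero              (even-ss (even-ss _))  _ (s≤s (s≤s ()))
even-gap (even-ss (even-ss _))  even-zero              (s≤s (s≤s ())) _
even-gap (even-ss ea) (even-ss eb) (s≤s (s≤s a≤)) (s≤s (s≤s b≤)) with even-gap ea eb a≤ b≤
... | inj₁ a+2≡b        = inj₁ (cong (2 +_) a+2≡b)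
... | inj₂ (inj₁ a≡b)   = inj₂ (inj₁ (cong (2 +_) a≡b))
... | inj₂ (inj₂ a≡b+2) = inj₂ (inj₂ (cong (2 +_) a≡b+2))

-- Both ranks are even (adjacency matrices are alternating) and each exceeds
-- the other by at most two, since switching is an involutive rank-two update.
proposition1p3 : (n : ℕ) (G : Graph n) (S : VSet n) → IsGMSwitchingSet G S →
    (r : ℕ) → Rank2 (adj G) r →
    Even r × (Σ ℕ λ r' → Rank2 (switchAdj G S) r' × ((r' + 2 ≡ r) ⊎ (r' ≡ r) ⊎ (r' ≡ r + 2)))
proposition1p3 _ G S _ r rk =
  r-even , r' , rk' , even-gap r'-even r-even
    (perturbed-rank-bound switched rk rk') (perturbed-rank-bound (perturbed-involutive switched) rk' rk)
  where
  switched : Perturbed (adj G) (halfVertex G S) S (switchAdj G S)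
  switched = switch-perturbed G S
  A-alternating : Alternating (adj G)
  A-alternating = Graph.sym G , Graph.irrefl G
  r-even : Even r
  r-even = alternating-rank-even r A-alternating rk
  r' : ℕ
  r' = proj₁ (rank-exists (switchAdj G S))
  rk' : Rank2 (switchAdj G S) r'
  rk' = proj₂ (rank-exists (switchAdj G S))
  r'-even : Even r'
  r'-even = alternating-rank-even r' (perturbed-alternating switched A-alternating) rk'
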